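{- For any $k\ge1$ there is a canonical isomorphism $\mathrm{coker}(\beta^{(k)})\simeq\mathcal{I}^kH^2(C)/\mathcal{I}^{k+1}H^2(C)$.
   Context: Let $\mathcal{R}$ be a (possibly non-commutative) ring, $\mathcal{I}$ a two-sided ideal (with $\mathcal{I}^j=\mathcal{R}$ for $j\le0$), and $C=[C^1\xrightarrow{d}C^2]$ a complex of left $\mathcal{R}$-modules in degrees 1 and 2, so $H^2(C)=\mathrm{coker}(d)$. The spectral sequence of the filtration $\{\mathcal{I}^iC\}$ is given by $Z_k^{i,j}=\ker(\mathcal{I}^iC^{i+j}\xrightarrow{d}C^{i+j+1}/\mathcal{I}^{i+k}C^{i+j+1})$, $B_k^{i,j}=\mathcal{I}^iC^{i+j}\cap d(\mathcal{I}^{i-k}C^{i+j-1})$, $E_k^{i,j}=Z_k^{i,j}/(Z_{k-1}^{i+1,j-1}+B_{k-1}^{i,j})$, with differentials $d_k^{i,j}:E_k^{i,j}\to E_k^{i+k,j+1-k}$ induced by $d$. The $k$-th derived Bockstein map is $\beta^{(k)}:=d_k^{0,1}:E_k^{0,1}\to E_k^{k,2-k}$. -}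

module Defs where

open import Level using (Level; _⊔_; Lift)
open import Algebra.Bundles using (Ring)
open import Algebra.Module.Bundles using (LeftModule)
open import Algebra.Module.Bundles.Raw using (RawLeftModule)
import Algebra.Module.Construct.Zero as Zero
open import Data.Integer as ℤ using (ℤ; +_; -[1+_]; 0ℤ; 1ℤ)
import Data.Integer.Properties as ℤP
open import Data.Nat as ℕ using (ℕ; zero; suc; _∸_)
open import Data.List using (List; foldr; map)
open import Data.List.Relation.Unary.All using (All)
open import Data.Product using (Σ; _×_; _,_; ∃; ∃-syntax; proj₁; proj₂)
open import Data.Unit.Polymorphic using (⊤)
open import Relation.Binary.PropositionalEquality using (_≡_; subst; cong; trans)

-- Integer helper: (n - 1) + 1 ≡ n   (needed to view d(C^{n-1}) inside C^n)

n-1+1≡n : ∀ n → (n ℤ.- 1ℤ) ℤ.+ 1ℤ ≡ n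
n-1+1≡n n = trans (ℤP.+-assoc n (ℤ.- 1ℤ) 1ℤ)
                  (trans (cong (λ t → n ℤ.+ t) (ℤP.+-inverseˡ 1ℤ)) (ℤP.+-identityʳ n))

-- Finite R-linear combinations in a raw left module, and the submodule
-- J·V = { Σ r_t v_t  |  r_t ∈ J }  (for a subset J of the ring).

module _ {r m ℓm : Level} {R : Set r} (V : RawLeftModule R m ℓm) where
  open RawLeftModule V

  sumᴹ : List Carrierᴹ → Carrierᴹ
  sumᴹ = foldr _+ᴹ_ 0ᴹ

  _-ᴹ_ : Carrierᴹ → Carrierᴹ → Carrierᴹ
  x -ᴹ y = x +ᴹ (-ᴹ y)

  span : {ℓJ : Level} → (R → Set ℓJ) → Carrierᴹ → Set (r ⊔ m ⊔ ℓm ⊔ ℓJ)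
  span J v = ∃[ ps ] (All (λ p → J (proj₁ p)) ps
                      × v ≈ᴹ sumᴹ (map (λ p → proj₁ p *ₗ proj₂ p) ps))

  -- the subquotient N/D of V (N ⊇ D submodules): elements of N, with
  -- x ~ y  iff  x - y ∈ D.  We only need the relation on underlying elements.
  SQ-rel : {ℓD : Level} → (Carrierᴹ → Set ℓD) → Carrierᴹ → Carrierᴹ → Set ℓD
  SQ-rel D x y = D (x -ᴹ y)

module _ {c ℓ : Level} (R : Ring c ℓ) where
  open Ring R

  record IsTwoSidedIdeal {ℓI : Level} (I : Carrier → Set ℓI) : Set (c ⊔ ℓ ⊔ ℓI) where
    field
      ≈-resp    : ∀ {x y} → x ≈ y → I x → I y
      0∈        : I 0#
      +-closed  : ∀ {x y} → I x → I y → I (x + y)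
      -‿closed  : ∀ {x} → I x → I (- x)
      *ˡ-closed : ∀ r {x} → I x → I (r * x)
      *ʳ-closed : ∀ {x} r → I x → I (x * r)

  sumR : List Carrier → Carrier
  sumR = foldr _+_ 0#

  idealProd : {ℓJ ℓK : Level} → (Carrier → Set ℓJ) → (Carrier → Set ℓK)
            → Carrier → Set (c ⊔ ℓ ⊔ ℓJ ⊔ ℓK)
  idealProd J K x = ∃[ ps ] (All (λ p → J (proj₁ p) × K (proj₂ p)) ps
                            × x ≈ sumR (map (λ p → proj₁ p * proj₂ p) ps))

  idealPow : {ℓI : Level} → (Carrier → Set ℓI) → ℕ → Carrier → Set (c ⊔ ℓ ⊔ ℓI)
  idealPow I zero    x = ⊤
  idealPow I (suc j) x = idealProd (idealPow I j) I x

  idealPowℤ : {ℓI : Level} → (Carrier → Set ℓI) → ℤ → Carrier → Set (c ⊔ ℓ ⊔ ℓI)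
  idealPowℤ I (+ n)    = idealPow I n
  idealPowℤ I -[1+ n ] = λ _ → ⊤

-- The spectral sequence of the I-adic filtration of a ℤ-graded complex
-- (C, d), indexed by (i, n) with n = i + j the total degree:
--   Zk k i n  =  Z_k^{i,n-i},  Bk k i n  =  B_k^{i,n-i},
--   E_k^{i,n-i} = Zk k i n / Ek-den k i n.

module SpectralSequence
  {c ℓ ℓI m ℓm : Level} (R : Ring c ℓ) (I : Ring.Carrier R → Set ℓI)
  (C : ℤ → LeftModule R m ℓm)
  (d : ∀ n → LeftModule.Carrierᴹ (C n) → LeftModule.Carrierᴹ (C (n ℤ.+ 1ℤ)))
  where

  Cr : ℤ → RawLeftModule (Ring.Carrier R) m ℓm
  Cr n = LeftModule.rawLeftModule (C n)

  Car : ℤ → Set m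
  Car n = LeftModule.Carrierᴹ (C n)

  F : ℤ → (n : ℤ) → Car n → Set _
  F i n = span (Cr n) (idealPowℤ R I i)

  Zk : ℕ → ℤ → (n : ℤ) → Car n → Set _
  Zk k i n x = F i n x × F (i ℤ.+ + k) (n ℤ.+ 1ℤ) (d n x)

  Bk : ℕ → ℤ → (n : ℤ) → Car n → Set _
  Bk k i n x = F i n x
             × ∃[ y ] (F (i ℤ.- + k) (n ℤ.- 1ℤ) y
                      × LeftModule._≈ᴹ_ (C n) (subst Car (n-1+1≡n n) (d (n ℤ.- 1ℤ) y)) x)

  -- denominator of E_k^{i,j}:  Z_{k-1}^{i+1,j-1} + B_{k-1}^{i,j}   (k ≥ 1)
  Ek-den : ℕ → ℤ → (n : ℤ) → Car n → Set _
  Ek-den k i n x = ∃[ a ] ∃[ b ] (Zk (k ∸ 1) (i ℤ.+ 1ℤ) n a × Bk (k ∸ 1) i n b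
                                 × LeftModule._≈ᴹ_ (C n) x (LeftModule._+ᴹ_ (C n) a b))

  Ek-rel : ℕ → ℤ → (n : ℤ) → Car n → Car n → Set _
  Ek-rel k i n = SQ-rel (Cr n) (Ek-den k i n)

  -- d_k^{i,j} : E_k^{i,j} → E_k^{i+k,j+1-k} is induced by d; its cokernel is
  --   Zk k (i+k) (n+1) / ( Ek-den k (i+k) (n+1) + d(Zk k i n) ).
  coker-dk-den : ℕ → ℤ → (n : ℤ) → Car (n ℤ.+ 1ℤ) → Set _
  coker-dk-den k i n y = ∃[ x ] ∃[ e ] (Zk k i n x × Ek-den k (i ℤ.+ + k) (n ℤ.+ 1ℤ) e
                          × LeftModule._≈ᴹ_ (C (n ℤ.+ 1ℤ)) y
                              (LeftModule._+ᴹ_ (C (n ℤ.+ 1ℤ)) (d n x) e))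

  coker-dk-num : ℕ → ℤ → (n : ℤ) → Car (n ℤ.+ 1ℤ) → Set _
  coker-dk-num k i n = Zk k (i ℤ.+ + k) (n ℤ.+ 1ℤ)

module _ {c ℓ m ℓm : Level} {R : Ring c ℓ} where

  twoTerm : (M₁ M₂ : LeftModule R m ℓm) → ℤ → LeftModule R m ℓm
  twoTerm M₁ M₂ (+ 1) = M₁
  twoTerm M₁ M₂ (+ 2) = M₂
  twoTerm M₁ M₂ _     = Zero.leftModule {m} {ℓm} {R = R}

  twoTermD : (M₁ M₂ : LeftModule R m ℓm)
           → (LeftModule.Carrierᴹ M₁ → LeftModule.Carrierᴹ M₂)
           → ∀ n → LeftModule.Carrierᴹ (twoTerm M₁ M₂ n)
                 → LeftModule.Carrierᴹ (twoTerm M₁ M₂ (n ℤ.+ 1ℤ))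
  twoTermD M₁ M₂ δ (+ 1) x = δ x
  twoTermD M₁ M₂ δ n     x = LeftModule.0ᴹ (twoTerm M₁ M₂ (n ℤ.+ 1ℤ))

  H2 : (M₁ M₂ : LeftModule R m ℓm)
     → (LeftModule.Carrierᴹ M₁ → LeftModule.Carrierᴹ M₂)
     → RawLeftModule (Ring.Carrier R) m (m ⊔ ℓm)
  H2 M₁ M₂ δ = record
    { Carrierᴹ = LeftModule.Carrierᴹ M₂
    ; _≈ᴹ_ = λ x y → ∃[ z ] LeftModule._≈ᴹ_ M₂ (_-ᴹ_ (LeftModule.rawLeftModule M₂) x y) (δ z)
    ; _+ᴹ_ = LeftModule._+ᴹ_ M₂
    ; _*ₗ_ = LeftModule._*ₗ_ M₂
    ; 0ᴹ = LeftModule.0ᴹ M₂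
    ; -ᴹ_ = LeftModule.-ᴹ_ M₂
    }

-- An isomorphism of left R-modules between subquotients N/D of V and
-- N'/D' of W which is induced by a given map φ : V → W on representatives
-- ("canonical": it sends the class of z to the class of φ z).

record InducedSQIso {r m ℓm m' ℓm' ℓN ℓD ℓN' ℓD' : Level} {R : Set r}
  (V : RawLeftModule R m ℓm) (N : RawLeftModule.Carrierᴹ V → Set ℓN)
  (D : RawLeftModule.Carrierᴹ V → Set ℓD)
  (W : RawLeftModule R m' ℓm') (N' : RawLeftModule.Carrierᴹ W → Set ℓN')
  (D' : RawLeftModule.Carrierᴹ W → Set ℓD')
  (φ : RawLeftModule.Carrierᴹ V → RawLeftModule.Carrierᴹ W)
  : Set (r ⊔ m ⊔ m' ⊔ ℓN ⊔ ℓD ⊔ ℓN' ⊔ ℓD') where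
  open RawLeftModule V renaming (Carrierᴹ to A; _+ᴹ_ to _+V_; _*ₗ_ to _*V_)
  open RawLeftModule W renaming (Carrierᴹ to B; _+ᴹ_ to _+W_; _*ₗ_ to _*W_)
  _~V_ = SQ-rel V D
  _~W_ = SQ-rel W D'
  field
    f          : Σ A N → Σ B N'
    canonical  : ∀ z → proj₁ (f z) ~W φ (proj₁ z)
    f-cong     : ∀ z z' → proj₁ z ~V proj₁ z' → proj₁ (f z) ~W proj₁ (f z')
    injective  : ∀ z z' → proj₁ (f z) ~W proj₁ (f z') → proj₁ z ~V proj₁ z'
    surjective : ∀ (w : Σ B N') → Σ (Σ A N) λ z → (proj₁ (f z) ~W proj₁ w)
    +-homo     : ∀ z z' (h : N (proj₁ z +V proj₁ z'))
               → proj₁ (f (proj₁ z +V proj₁ z' , h)) ~W (proj₁ (f z) +W proj₁ (f z'))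
    *-homo     : ∀ s z (h : N (s *V proj₁ z))
               → proj₁ (f (s *V proj₁ z , h)) ~W (s *W proj₁ (f z))

-- The numerator of coker β⁽ᵏ⁾ is Iᵏ C², and unwinding the definitions its
-- denominator is (Iᵏ⁺¹ C² + d C¹) ∩ Iᵏ C².  On the other side, an element of C²
-- lies in Iʲ H² exactly when it is congruent modulo d C¹ to an element of Iʲ C².
-- So the identity of C² induces
--   Iᵏ C² / ((Iᵏ⁺¹ C² + d C¹) ∩ Iᵏ C²)  ≅  (Iᵏ C² + d C¹) / (Iᵏ⁺¹ C² + d C¹),
-- an instance of the second isomorphism theorem.
module Submission where

open import Defs
open import Algebra.Bundles using (Ring)
open import Algebra.Module.Bundles using (LeftModule)
open import Algebra.Module.Bundles.Raw using (RawLeftModule)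
open import Algebra.Module.Morphism.Structures using (module LeftModuleMorphisms)
open import Data.Nat using (ℕ; suc; _≤_)
open import Data.Nat.Properties using (+-comm)
open import Data.Integer using (0ℤ; 1ℤ; _+_; +_)
open import Data.List using (List; []; _∷_; _++_; map)
open import Data.List.Relation.Unary.All as All using (All; []; _∷_)
open import Data.List.Relation.Unary.All.Properties using (++⁺; map⁺)
open import Data.Product using (_×_; _,_; ∃-syntax; proj₁; proj₂)
open import Level using (Level)
open import Relation.Binary.PropositionalEquality using (subst)

module SpanProperties {c ℓ m ℓm : Level} {R : Ring c ℓ} (M : LeftModule R m ℓm) where
  open Ring R using (Carrier; 1#; _*_) renaming (_+_ to _+ᴿ_)
  open LeftModule M
  open import Algebra.Module.Properties.LeftModule M using (inverseʳ-uniqueᴹ)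
  open import Algebra.Properties.AbelianGroup +ᴹ-abelianGroup using (ε⁻¹≈ε; ⁻¹-∙-comm)
  open import Relation.Binary.Reasoning.Setoid ≈ᴹ-setoid

  Span : ∀ {ℓJ} → (Carrier → Set ℓJ) → Carrierᴹ → Set _
  Span = span rawLeftModule

  combination : List (Carrier × Carrierᴹ) → Carrierᴹ
  combination ps = sumᴹ rawLeftModule (map (λ p → proj₁ p *ₗ proj₂ p) ps)

  combination-++ : ∀ ps qs → combination (ps ++ qs) ≈ᴹ combination ps +ᴹ combination qs
  combination-++ []             qs = ≈ᴹ-sym (+ᴹ-identityˡ _)
  combination-++ ((r , v) ∷ ps) qs = begin
    r *ₗ v +ᴹ combination (ps ++ qs)             ≈⟨ +ᴹ-congˡ (combination-++ ps qs) ⟩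
    r *ₗ v +ᴹ (combination ps +ᴹ combination qs) ≈⟨ +ᴹ-assoc _ _ _ ⟨
    r *ₗ v +ᴹ combination ps +ᴹ combination qs   ∎

  -ᴹ-*ₗ : ∀ r v → -ᴹ (r *ₗ v) ≈ᴹ r *ₗ (-ᴹ v)
  -ᴹ-*ₗ r v = ≈ᴹ-sym (inverseʳ-uniqueᴹ (r *ₗ v) (r *ₗ (-ᴹ v)) (begin
    r *ₗ v +ᴹ r *ₗ (-ᴹ v) ≈⟨ *ₗ-distribˡ r v (-ᴹ v) ⟨
    r *ₗ (v +ᴹ -ᴹ v)      ≈⟨ *ₗ-congˡ (-ᴹ‿inverseʳ v) ⟩
    r *ₗ 0ᴹ               ≈⟨ *ₗ-zeroʳ r ⟩
    0ᴹ                    ∎))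

  -ᴹ-combination : ∀ ps →
    -ᴹ combination ps ≈ᴹ combination (map (λ p → proj₁ p , -ᴹ proj₂ p) ps)
  -ᴹ-combination []             = ε⁻¹≈ε
  -ᴹ-combination ((r , v) ∷ ps) = begin
    -ᴹ (r *ₗ v +ᴹ combination ps)    ≈⟨ ⁻¹-∙-comm _ _ ⟨
    -ᴹ (r *ₗ v) +ᴹ -ᴹ combination ps ≈⟨ +ᴹ-cong (-ᴹ-*ₗ r v) (-ᴹ-combination ps) ⟩
    r *ₗ (-ᴹ v) +ᴹ combination (map (λ p → proj₁ p , -ᴹ proj₂ p) ps) ∎

  sumR-*ₗ : ∀ (qs : List (Carrier × Carrier)) v →
    sumR R (map (λ q → proj₁ q * proj₂ q) qs) *ₗ v
      ≈ᴹ combination (map (λ q → proj₁ q , proj₂ q *ₗ v) qs)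
  sumR-*ₗ []             v = *ₗ-zeroˡ v
  sumR-*ₗ ((a , b) ∷ qs) v = begin
    (a * b +ᴿ sumR R (map (λ q → proj₁ q * proj₂ q) qs)) *ₗ v
      ≈⟨ *ₗ-distribʳ v _ _ ⟩
    (a * b) *ₗ v +ᴹ sumR R (map (λ q → proj₁ q * proj₂ q) qs) *ₗ v
      ≈⟨ +ᴹ-cong (*ₗ-assoc a b v) (sumR-*ₗ qs v) ⟩
    a *ₗ (b *ₗ v) +ᴹ combination (map (λ q → proj₁ q , proj₂ q *ₗ v) qs) ∎

  module _ {ℓJ} {J : Carrier → Set ℓJ} where

    span-resp : ∀ {x y} → x ≈ᴹ y → Span J y → Span J x
    span-resp x≈y (ps , ps∈J , y≈) = ps , ps∈J , ≈ᴹ-trans x≈y y≈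

    span-0ᴹ : Span J 0ᴹ
    span-0ᴹ = [] , [] , ≈ᴹ-refl

    span-+ᴹ : ∀ {x y} → Span J x → Span J y → Span J (x +ᴹ y)
    span-+ᴹ (ps , ps∈J , x≈) (qs , qs∈J , y≈) =
      ps ++ qs , ++⁺ ps∈J qs∈J , ≈ᴹ-trans (+ᴹ-cong x≈ y≈) (≈ᴹ-sym (combination-++ ps qs))

    span-neg : ∀ {x} → Span J x → Span J (-ᴹ x)
    span-neg (ps , ps∈J , x≈) =
      _ , map⁺ ps∈J , ≈ᴹ-trans (-ᴹ‿cong x≈) (-ᴹ-combination ps)

    span-diff : ∀ {x y} → Span J x → Span J y → Span J (x +ᴹ -ᴹ y)
    span-diff x∈ y∈ = span-+ᴹ x∈ (span-neg y∈)

    1∈J⇒span : J 1# → ∀ v → Span J v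
    1∈J⇒span 1∈J v =
      (1# , v) ∷ [] , 1∈J ∷ [] , ≈ᴹ-sym (≈ᴹ-trans (+ᴹ-identityʳ _) (*ₗ-identityˡ v))

  span-idealProd⇒span : ∀ {ℓJ ℓK} {J : Carrier → Set ℓJ} {K : Carrier → Set ℓK} {x} →
    Span (idealProd R J K) x → Span J x
  span-idealProd⇒span {J = J} {K} (ps , ps∈JK , x≈) = span-resp x≈ (combination∈span ps ps∈JK)
    where
    combination∈span : ∀ ps → All (λ p → idealProd R J K (proj₁ p)) ps → Span J (combination ps)
    combination∈span []             []                        = span-0ᴹ
    combination∈span ((r , v) ∷ ps) ((qs , qs∈JK , r≈) ∷ ps∈JK) =
      span-+ᴹ (span-resp (≈ᴹ-trans (*ₗ-congʳ r≈) (sumR-*ₗ qs v))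
                         (_ , map⁺ (All.map proj₁ qs∈JK) , ≈ᴹ-refl))
              (combination∈span ps ps∈JK)

module Cokernel {c ℓ m ℓm : Level} {R : Ring c ℓ} (M₁ M₂ : LeftModule R m ℓm)
  (δ : LeftModule.Carrierᴹ M₁ → LeftModule.Carrierᴹ M₂)
  (hom : LeftModuleMorphisms.IsLeftModuleHomomorphism
           (LeftModule.rawLeftModule M₁) (LeftModule.rawLeftModule M₂) δ)
  where
  open LeftModule M₂
  private module M₁ = LeftModule M₁
  open LeftModuleMorphisms.IsLeftModuleHomomorphism hom using (+ᴹ-homo; 0ᴹ-homo; -ᴹ-homo)
  open import Algebra.Properties.AbelianGroup +ᴹ-abelianGroup
    using (ε⁻¹≈ε; ⁻¹-anti-homo‿-; //-rightDividesˡ; x≈y⇒x∙y⁻¹≈ε)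
  open SpanProperties M₂
  open import Relation.Binary.Reasoning.Setoid ≈ᴹ-setoid

  _≈ᴴ_ : Carrierᴹ → Carrierᴹ → Set _
  _≈ᴴ_ = RawLeftModule._≈ᴹ_ (H2 M₁ M₂ δ)

  ≈ᴹ⇒≈ᴴ : ∀ {x y} → x ≈ᴹ y → x ≈ᴴ y
  ≈ᴹ⇒≈ᴴ x≈y = M₁.0ᴹ , ≈ᴹ-trans (x≈y⇒x∙y⁻¹≈ε x≈y) (≈ᴹ-sym 0ᴹ-homo)

  ≈ᴴ-refl : ∀ {x} → x ≈ᴴ x
  ≈ᴴ-refl = ≈ᴹ⇒≈ᴴ ≈ᴹ-refl

  ≈ᴴ-sym : ∀ {x y} → x ≈ᴴ y → y ≈ᴴ x
  ≈ᴴ-sym {x} {y} (z , x-y≈δz) = M₁.-ᴹ z , (begin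
    y +ᴹ -ᴹ x      ≈⟨ ⁻¹-anti-homo‿- x y ⟨
    -ᴹ (x +ᴹ -ᴹ y) ≈⟨ -ᴹ‿cong x-y≈δz ⟩
    -ᴹ δ z         ≈⟨ -ᴹ-homo z ⟨
    δ (M₁.-ᴹ z)    ∎)

  ≈ᴴ-trans : ∀ {x y w} → x ≈ᴴ y → y ≈ᴴ w → x ≈ᴴ w
  ≈ᴴ-trans {x} {y} {w} (z , x-y≈δz) (z′ , y-w≈δz′) = z M₁.+ᴹ z′ , (begin
    x +ᴹ -ᴹ w                   ≈⟨ +ᴹ-congʳ (//-rightDividesˡ y x) ⟨
    (x +ᴹ -ᴹ y) +ᴹ y +ᴹ -ᴹ w    ≈⟨ +ᴹ-assoc _ _ _ ⟩
    (x +ᴹ -ᴹ y) +ᴹ (y +ᴹ -ᴹ w)  ≈⟨ +ᴹ-cong x-y≈δz y-w≈δz′ ⟩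
    δ z +ᴹ δ z′                 ≈⟨ +ᴹ-homo z z′ ⟨
    δ (z M₁.+ᴹ z′)              ∎)

  module _ {ℓJ} {J : Ring.Carrier R → Set ℓJ} where

    spanᴴ⇒ : ∀ {y} → span (H2 M₁ M₂ δ) J y → ∃[ a ] Span J a × y ≈ᴴ a
    spanᴴ⇒ (ps , ps∈J , y≈) = combination ps , (ps , ps∈J , ≈ᴹ-refl) , y≈

    ⇒spanᴴ : ∀ {y a} → Span J a → y ≈ᴴ a → span (H2 M₁ M₂ δ) J y
    ⇒spanᴴ (ps , ps∈J , a≈) y≈a = ps , ps∈J , ≈ᴴ-trans y≈a (≈ᴹ⇒≈ᴴ a≈)

    ≈ᴴ⇒spanᴴ-diff : ∀ {x y} → x ≈ᴴ y → span (H2 M₁ M₂ δ) J (x +ᴹ -ᴹ y)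
    ≈ᴴ⇒spanᴴ-diff {x} {y} (z , x-y≈δz) = [] , [] , z , (begin
      (x +ᴹ -ᴹ y) +ᴹ -ᴹ 0ᴹ ≈⟨ +ᴹ-congˡ ε⁻¹≈ε ⟩
      (x +ᴹ -ᴹ y) +ᴹ 0ᴹ    ≈⟨ +ᴹ-identityʳ _ ⟩
      x +ᴹ -ᴹ y            ≈⟨ x-y≈δz ⟩
      δ z                  ∎)

module CokernelOfBockstein {c ℓ ℓI m ℓm : Level} (R : Ring c ℓ) (I : Ring.Carrier R → Set ℓI)
  (M₁ M₂ : LeftModule R m ℓm)
  (δ : LeftModule.Carrierᴹ M₁ → LeftModule.Carrierᴹ M₂)
  (hom : LeftModuleMorphisms.IsLeftModuleHomomorphism
           (LeftModule.rawLeftModule M₁) (LeftModule.rawLeftModule M₂) δ)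
  (k : ℕ)
  where
  open SpectralSequence R I (twoTerm M₁ M₂) (twoTermD M₁ M₂ δ)
  open LeftModule M₂
  private module M₁ = LeftModule M₁
  open LeftModuleMorphisms.IsLeftModuleHomomorphism hom using (+ᴹ-homo; 0ᴹ-homo)
  open import Algebra.Properties.AbelianGroup +ᴹ-abelianGroup
    using (//-rightDividesˡ; //-rightDividesʳ)
  open SpanProperties M₂
  open Cokernel M₁ M₂ δ hom
  open import Relation.Binary.Reasoning.Setoid ≈ᴹ-setoid

  cokerβ-den⇒ : ∀ {y} → coker-dk-den (suc k) 0ℤ 1ℤ y →
    ∃[ a ] Span (idealPow R I (suc (suc k))) a × y ≈ᴴ a
  cokerβ-den⇒ {y} (x , e , _ , (a , b , (a∈ , _) , (_ , u , _ , δu≈b) , e≈a+b) , y≈δx+e) =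
    a , subst (λ j → Span (idealPow R I (suc j)) a) (+-comm k 1) a∈ , x M₁.+ᴹ u , (begin
      y +ᴹ -ᴹ a                 ≈⟨ +ᴹ-congʳ y≈δx+b+a ⟩
      (δ x +ᴹ (b +ᴹ a)) +ᴹ -ᴹ a ≈⟨ +ᴹ-congʳ (+ᴹ-assoc _ _ _) ⟨
      (δ x +ᴹ b) +ᴹ a +ᴹ -ᴹ a   ≈⟨ //-rightDividesʳ a (δ x +ᴹ b) ⟩
      δ x +ᴹ b                  ≈⟨ +ᴹ-congˡ δu≈b ⟨
      δ x +ᴹ δ u                ≈⟨ +ᴹ-homo x u ⟨
      δ (x M₁.+ᴹ u)             ∎)
    where
    y≈δx+b+a : y ≈ᴹ δ x +ᴹ (b +ᴹ a)
    y≈δx+b+a = ≈ᴹ-trans y≈δx+e (+ᴹ-congˡ (≈ᴹ-trans e≈a+b (+ᴹ-comm a b)))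

  ⇒cokerβ-den : ∀ {y a} → Span (idealPow R I (suc k)) y →
    Span (idealPow R I (suc (suc k))) a → y ≈ᴴ a → coker-dk-den (suc k) 0ℤ 1ℤ y
  ⇒cokerβ-den {y} {a} y∈ a∈ (x , y-a≈δx) = x , a , x∈Z , a∈den , y≈δx+a
    where
    δx∈ : Span (idealPow R I (suc k)) (δ x)
    δx∈ = span-resp (≈ᴹ-sym y-a≈δx) (span-diff y∈ (span-idealProd⇒span a∈))

    x∈Z : Zk (suc k) 0ℤ 1ℤ x
    x∈Z = SpanProperties.1∈J⇒span M₁ _ x , δx∈

    a∈′ : Span (idealPow R I (suc k Data.Nat.+ 1)) a
    a∈′ = subst (λ j → Span (idealPow R I (suc j)) a) (+-comm 1 k) a∈

    -- a = a + 0 with a ∈ Z and 0 ∈ B; the conditions in C³ = 0 hold vacuously.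
    a∈den : Ek-den (suc k) (0ℤ + + suc k) (1ℤ + 1ℤ) a
    a∈den = a , 0ᴹ , (a∈′ , [] , [] , _)
          , (span-0ᴹ , M₁.0ᴹ , SpanProperties.span-0ᴹ M₁ , 0ᴹ-homo)
          , ≈ᴹ-sym (+ᴹ-identityʳ a)

    y≈δx+a : y ≈ᴹ δ x +ᴹ a
    y≈δx+a = ≈ᴹ-trans (≈ᴹ-sym (//-rightDividesˡ a y)) (+ᴹ-congʳ y-a≈δx)

propositionA8 : ∀ {c ℓ ℓI m ℓm} (R : Ring c ℓ) (I : Ring.Carrier R → Set ℓI)
    → IsTwoSidedIdeal R I
    → (M₁ M₂ : LeftModule R m ℓm)
    → (δ : LeftModule.Carrierᴹ M₁ → LeftModule.Carrierᴹ M₂)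
    → LeftModuleMorphisms.IsLeftModuleHomomorphism (LeftModule.rawLeftModule M₁) (LeftModule.rawLeftModule M₂) δ
    → (k : ℕ) → 1 ≤ k
    → InducedSQIso
        (SpectralSequence.Cr R I (twoTerm M₁ M₂) (twoTermD M₁ M₂ δ) (1ℤ + 1ℤ))
        (SpectralSequence.coker-dk-num R I (twoTerm M₁ M₂) (twoTermD M₁ M₂ δ) k 0ℤ 1ℤ)
        (SpectralSequence.coker-dk-den R I (twoTerm M₁ M₂) (twoTermD M₁ M₂ δ) k 0ℤ 1ℤ)
        (H2 M₁ M₂ δ)
        (span (H2 M₁ M₂ δ) (idealPow R I k))
        (span (H2 M₁ M₂ δ) (idealPow R I (suc k)))
        (λ x → x)
propositionA8 R I _ M₁ M₂ δ hom (suc k) _ = record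
  { f          = λ { (y , y∈ , _) → y , ⇒spanᴴ y∈ ≈ᴴ-refl }
  ; canonical  = λ _ → ≈ᴴ⇒spanᴴ-diff ≈ᴴ-refl
  ; f-cong     = λ _ _ y-y′∈den →
      let (a , a∈ , y-y′≈a) = cokerβ-den⇒ y-y′∈den in ⇒spanᴴ a∈ y-y′≈a
  ; injective  = λ { (y , y∈ , _) (y′ , y′∈ , _) y-y′∈Iᴴ →
      let (a , a∈ , y-y′≈a) = spanᴴ⇒ y-y′∈Iᴴ in ⇒cokerβ-den (span-diff y∈ y′∈) a∈ y-y′≈a }
  ; surjective = λ { (w , w∈) →
      let (a , a∈ , w≈a) = spanᴴ⇒ w∈ in (a , a∈ , [] , [] , _) , ≈ᴴ⇒spanᴴ-diff (≈ᴴ-sym w≈a) }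
  ; +-homo     = λ _ _ _ → ≈ᴴ⇒spanᴴ-diff ≈ᴴ-refl
  ; *-homo     = λ _ _ _ → ≈ᴴ⇒spanᴴ-diff ≈ᴴ-refl
  }
  where
  open SpanProperties M₂ using (span-diff)
  open Cokernel M₁ M₂ δ hom
  open CokernelOfBockstein R I M₁ M₂ δ hom k
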